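{- For all $w\in F_2$, $L_w(ba)=\mathrm{Pal}(w)\,ba$.
   Context: $F_2$ is the free group on $a,b$. $w\mapsto R_w$ is the group homomorphism $F_2\to\mathrm{Aut}(F_2)$ with $R_a(a)=a$, $R_a(b)=ba$, $R_b(a)=ab$, $R_b(b)=b$. The palindromization map $\mathrm{Pal}:F_2\to F_2$ is defined by $\mathrm{Pal}(w)=b^{ -1}a^{ -1}R_w(ab)$. $w\mapsto L_w$ is the group homomorphism $F_2\to\mathrm{Aut}(F_2)$ with $L_a(a)=a$, $L_a(b)=ab$, $L_b(a)=ba$, $L_b(b)=b$. -}

module Defs where

open import Data.Bool using (Bool; true; false; not; _∧_; if_then_else_)
open import Data.List using (List; []; _∷_; _++_; reverse; map; concatMap; foldr)
open import Relation.Binary.PropositionalEquality using (_≡_)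

data Letter : Set where
  a b : Letter

data Gen : Set where
  pos : Letter → Gen
  neg : Letter → Gen

-- Words in the generators and their inverses (elements of F₂ up to free reduction)
Word : Set
Word = List Gen

inv-gen : Gen → Gen
inv-gen (pos x) = neg x
inv-gen (neg x) = pos x

inv : Word → Word
inv w = reverse (map inv-gen w)

letter-eq : Letter → Letter → Bool
letter-eq a a = true
letter-eq b b = true
letter-eq _ _ = false

cancels : Gen → Gen → Bool
cancels (pos x) (neg y) = letter-eq x y
cancels (neg x) (pos y) = letter-eq x y
cancels _ _ = false

push : Gen → Word → Word
push g [] = g ∷ []
push g (h ∷ t) = if cancels g h then t else g ∷ h ∷ t

reduce : Word → Word
reduce = foldr push []

infix 4 _≈_
_≈_ : Word → Word → Set
u ≈ v = reduce u ≡ reduce v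

subst : Word → Word → Word → Word
subst ia ib = concatMap img
  where
  im : Letter → Word
  im a = ia
  im b = ib
  img : Gen → Word
  img (pos x) = im x
  img (neg x) = inv (im x)

-- R on generators and their inverses:
-- R_a : a ↦ a, b ↦ ba ;  R_a⁻¹ : a ↦ a, b ↦ ba⁻¹
-- R_b : a ↦ ab, b ↦ b ;  R_b⁻¹ : a ↦ ab⁻¹, b ↦ b
Rgen : Gen → Word → Word
Rgen (pos a) = subst (pos a ∷ []) (pos b ∷ pos a ∷ [])
Rgen (neg a) = subst (pos a ∷ []) (pos b ∷ neg a ∷ [])
Rgen (pos b) = subst (pos a ∷ pos b ∷ []) (pos b ∷ [])
Rgen (neg b) = subst (pos a ∷ neg b ∷ []) (pos b ∷ [])

-- L on generators and their inverses:
-- L_a : a ↦ a, b ↦ ab ;  L_a⁻¹ : a ↦ a, b ↦ a⁻¹b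
-- L_b : a ↦ ba, b ↦ b ;  L_b⁻¹ : a ↦ b⁻¹a, b ↦ b
Lgen : Gen → Word → Word
Lgen (pos a) = subst (pos a ∷ []) (pos a ∷ pos b ∷ [])
Lgen (neg a) = subst (pos a ∷ []) (neg a ∷ pos b ∷ [])
Lgen (pos b) = subst (pos b ∷ pos a ∷ []) (pos b ∷ [])
Lgen (neg b) = subst (neg b ∷ pos a ∷ []) (pos b ∷ [])

-- the homomorphisms w ↦ R_w, w ↦ L_w : F₂ → Aut(F₂),
-- R_{g₁⋯gₙ} = R_{g₁} ∘ ⋯ ∘ R_{gₙ}
R : Word → Word → Word
R [] x = x
R (g ∷ w) x = Rgen g (R w x)

L : Word → Word → Word
L [] x = x
L (g ∷ w) x = Lgen g (L w x)

ab ba : Word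
ab = pos a ∷ pos b ∷ []
ba = pos b ∷ pos a ∷ []

Pal : Word → Word
Pal w = neg b ∷ neg a ∷ R w ab

module Submission where

-- For a single generator g the automorphisms L_g and R_g differ
-- by an inner automorphism:  L_g(x) = g R_g(x) g⁻¹  for every x ∈ F₂.
-- Writing the claim as  L_w(ba) = b⁻¹a⁻¹ R_w(ab) ba,  induction on w gives
--   L_{gw}(ba) = L_g(b⁻¹a⁻¹ X ba) = (g R_g(b⁻¹a⁻¹)) R_g(X) (R_g(ba) g⁻¹)
-- with X = R_w(ab), and the two outer factors collapse back to b⁻¹a⁻¹ and ba
-- (a finite check on the four generators), giving b⁻¹a⁻¹ R_g(X) ba.

open import Defs
open import Data.List using (_++_; []; _∷_; foldr; map)
open import Data.List.Properties
  using (foldr-++; ++-assoc; ++-identityʳ; unfold-reverse; concatMap-++)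
open import Data.Bool using (true; false)
open import Relation.Binary.Bundles using (Setoid)
open import Relation.Binary.PropositionalEquality
  using (_≡_; refl; sym; trans; cong; cong₂)
import Relation.Binary.Reasoning.Setoid as SetoidReasoning

data Reduced : Word → Set where
  reduced-[] : Reduced []
  reduced-[_] : ∀ g → Reduced (g ∷ [])
  reduced-∷ : ∀ {g h t} → cancels g h ≡ false → Reduced (h ∷ t) → Reduced (g ∷ h ∷ t)

push-reduced : ∀ g {t} → Reduced t → Reduced (push g t)
push-reduced g reduced-[] = reduced-[ g ]
push-reduced g (reduced-[ h ]) with cancels g h in e
... | true = reduced-[]
... | false = reduced-∷ e reduced-[ h ]
push-reduced g (reduced-∷ {g = h} e′ r) with cancels g h in e
... | true = r
... | false = reduced-∷ e (reduced-∷ e′ r)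

reduce-reduced : ∀ u → Reduced (reduce u)
reduce-reduced [] = reduced-[]
reduce-reduced (g ∷ u) = push-reduced g (reduce-reduced u)

cancels-unique : ∀ g h k → cancels g h ≡ true → cancels h k ≡ true → g ≡ k
cancels-unique (pos a) (neg a) (pos a) refl refl = refl
cancels-unique (pos b) (neg b) (pos b) refl refl = refl
cancels-unique (neg a) (pos a) (neg a) refl refl = refl
cancels-unique (neg b) (pos b) (neg b) refl refl = refl

push-cancel : ∀ g h {t} → cancels g h ≡ true → Reduced t → push g (push h t) ≡ t
push-cancel g h e reduced-[] rewrite e = refl
push-cancel g h {k ∷ t} e r with cancels h k in e′
push-cancel g h e r | false rewrite e = refl
push-cancel g h e reduced-[ k ] | true with cancels-unique g h k e e′
... | refl = refl
push-cancel g h e (reduced-∷ e″ _) | true with cancels-unique g h _ e e′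
... | refl rewrite e″ = refl

act : Word → Word → Word
act u t = foldr push t u

act-reduced : ∀ u {t} → Reduced t → Reduced (act u t)
act-reduced [] r = r
act-reduced (g ∷ u) r = push-reduced g (act-reduced u r)

act-push : ∀ g {r t} → Reduced r → Reduced t → act (push g r) t ≡ push g (act r t)
act-push g reduced-[] rt = refl
act-push g {h ∷ r} _ rt with cancels g h in e
... | true = sym (push-cancel g h e (act-reduced r rt))
... | false = refl

act-reduce : ∀ u {t} → Reduced t → act u t ≡ act (reduce u) t
act-reduce [] rt = refl
act-reduce (g ∷ u) rt =
  trans (cong (push g) (act-reduce u rt)) (sym (act-push g (reduce-reduced u) rt))

reduce-++ : ∀ u v → reduce (u ++ v) ≡ act (reduce u) (reduce v)
reduce-++ u v = trans (foldr-++ push [] u v) (act-reduce u (reduce-reduced v))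

≈-setoid : Setoid _ _
≈-setoid = record
  { Carrier = Word
  ; _≈_ = _≈_
  ; isEquivalence = record { refl = refl ; sym = sym ; trans = trans }
  }

open SetoidReasoning ≈-setoid

++-cong : ∀ u u′ v v′ → u ≈ u′ → v ≈ v′ → (u ++ v) ≈ (u′ ++ v′)
++-cong u u′ v v′ p q =
  trans (reduce-++ u v) (trans (cong₂ act p q) (sym (reduce-++ u′ v′)))

++-congˡ : ∀ u u′ v → u ≈ u′ → (u ++ v) ≈ (u′ ++ v)
++-congˡ u u′ v p = ++-cong u u′ v v p refl

++-congʳ : ∀ u v v′ → v ≈ v′ → (u ++ v) ≈ (u ++ v′)
++-congʳ u v v′ q = ++-cong u u v v′ refl q

cancel-pair : ∀ g h u → cancels g h ≡ true → (g ∷ h ∷ u) ≈ u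
cancel-pair g h u e = push-cancel g h e (reduce-reduced u)

inv-cancels-left : ∀ g → cancels (inv-gen g) g ≡ true
inv-cancels-left (pos a) = refl
inv-cancels-left (pos b) = refl
inv-cancels-left (neg a) = refl
inv-cancels-left (neg b) = refl

inv-cancels-right : ∀ g → cancels g (inv-gen g) ≡ true
inv-cancels-right (pos a) = refl
inv-cancels-right (pos b) = refl
inv-cancels-right (neg a) = refl
inv-cancels-right (neg b) = refl

inv-∷ : ∀ g u → inv (g ∷ u) ≡ inv u ++ (inv-gen g ∷ [])
inv-∷ g u = unfold-reverse (inv-gen g) (map inv-gen u)

inv-left : ∀ u → (inv u ++ u) ≈ []
inv-left [] = refl
inv-left (g ∷ u) = begin
  inv (g ∷ u) ++ g ∷ u               ≡⟨ cong (_++ g ∷ u) (inv-∷ g u) ⟩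
  (inv u ++ g′ ∷ []) ++ g ∷ u        ≡⟨ ++-assoc (inv u) (g′ ∷ []) (g ∷ u) ⟩
  inv u ++ g′ ∷ g ∷ u                ≈⟨ ++-congʳ (inv u) (g′ ∷ g ∷ u) u
                                          (cancel-pair g′ g u (inv-cancels-left g)) ⟩
  inv u ++ u                         ≈⟨ inv-left u ⟩
  [] ∎
  where g′ = inv-gen g

inv-right : ∀ u → (u ++ inv u) ≈ []
inv-right [] = refl
inv-right (g ∷ u) = begin
  g ∷ u ++ inv (g ∷ u)               ≡⟨ cong (λ z → g ∷ u ++ z) (inv-∷ g u) ⟩
  g ∷ u ++ inv u ++ g′ ∷ []          ≡⟨ cong (g ∷_) (sym (++-assoc u (inv u) _)) ⟩
  (g ∷ []) ++ (u ++ inv u) ++ g′ ∷ [] ≈⟨ ++-congʳ (g ∷ []) ((u ++ inv u) ++ g′ ∷ []) (g′ ∷ [])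
                                          (++-congˡ (u ++ inv u) [] (g′ ∷ []) (inv-right u)) ⟩
  g ∷ g′ ∷ []                        ≈⟨ cancel-pair g g′ [] (inv-cancels-right g) ⟩
  [] ∎
  where g′ = inv-gen g

module Substitution (ia ib : Word) where
  f : Word → Word
  f = subst ia ib

  f-++ : ∀ u v → f (u ++ v) ≡ f u ++ f v
  f-++ u v = concatMap-++ _ u v

  f-cancels : ∀ g h → cancels g h ≡ true → (f (g ∷ []) ++ f (h ∷ [])) ≈ []
  f-cancels (pos a) (neg a) _ =
    trans (cong reduce (cong₂ _++_ (++-identityʳ ia) (++-identityʳ (inv ia)))) (inv-right ia)
  f-cancels (pos b) (neg b) _ =
    trans (cong reduce (cong₂ _++_ (++-identityʳ ib) (++-identityʳ (inv ib)))) (inv-right ib)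
  f-cancels (neg a) (pos a) _ =
    trans (cong reduce (cong₂ _++_ (++-identityʳ (inv ia)) (++-identityʳ ia))) (inv-left ia)
  f-cancels (neg b) (pos b) _ =
    trans (cong reduce (cong₂ _++_ (++-identityʳ (inv ib)) (++-identityʳ ib))) (inv-left ib)

  f-push : ∀ g r → f (push g r) ≈ f (g ∷ r)
  f-push g [] = refl
  f-push g (h ∷ t) with cancels g h in e
  ... | false = refl
  ... | true = sym (begin
    f (g ∷ h ∷ t)                          ≡⟨ f-++ (g ∷ []) (h ∷ t) ⟩
    f (g ∷ []) ++ f (h ∷ t)                ≡⟨ cong (f (g ∷ []) ++_) (f-++ (h ∷ []) t) ⟩
    f (g ∷ []) ++ f (h ∷ []) ++ f t        ≡⟨ sym (++-assoc (f (g ∷ [])) _ _) ⟩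
    (f (g ∷ []) ++ f (h ∷ [])) ++ f t      ≈⟨ ++-congˡ (f (g ∷ []) ++ f (h ∷ [])) [] (f t)
                                                 (f-cancels g h e) ⟩
    f t ∎)

  f-reduce : ∀ u → f u ≈ f (reduce u)
  f-reduce [] = refl
  f-reduce (g ∷ u) = begin
    f (g ∷ u)                  ≡⟨ f-++ (g ∷ []) u ⟩
    f (g ∷ []) ++ f u          ≈⟨ ++-congʳ (f (g ∷ [])) (f u) (f (reduce u)) (f-reduce u) ⟩
    f (g ∷ []) ++ f (reduce u) ≡⟨ sym (f-++ (g ∷ []) (reduce u)) ⟩
    f (g ∷ reduce u)           ≈⟨ f-push g (reduce u) ⟨
    f (push g (reduce u)) ∎

  f-cong : ∀ u v → u ≈ v → f u ≈ f v
  f-cong u v p = begin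
    f u          ≈⟨ f-reduce u ⟩
    f (reduce u) ≡⟨ cong f p ⟩
    f (reduce v) ≈⟨ f-reduce v ⟨
    f v ∎

Lgen-cong : ∀ g u v → u ≈ v → Lgen g u ≈ Lgen g v
Lgen-cong (pos a) = Substitution.f-cong _ _
Lgen-cong (neg a) = Substitution.f-cong _ _
Lgen-cong (pos b) = Substitution.f-cong _ _
Lgen-cong (neg b) = Substitution.f-cong _ _

Lgen-++ : ∀ g u v → Lgen g (u ++ v) ≡ Lgen g u ++ Lgen g v
Lgen-++ (pos a) = Substitution.f-++ _ _
Lgen-++ (neg a) = Substitution.f-++ _ _
Lgen-++ (pos b) = Substitution.f-++ _ _
Lgen-++ (neg b) = Substitution.f-++ _ _

Rgen-++ : ∀ g u v → Rgen g (u ++ v) ≡ Rgen g u ++ Rgen g v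
Rgen-++ (pos a) = Substitution.f-++ _ _
Rgen-++ (neg a) = Substitution.f-++ _ _
Rgen-++ (pos b) = Substitution.f-++ _ _
Rgen-++ (neg b) = Substitution.f-++ _ _

conjugate : Word → Word → Word
conjugate u x = u ++ x ++ inv u

-- Conjugation is multiplicative: the inner u⁻¹u cancels.
conjugate-++ : ∀ u x y → (conjugate u x ++ conjugate u y) ≈ conjugate u (x ++ y)
conjugate-++ u x y = begin
  (u ++ x ++ inv u) ++ u ++ y ++ inv u   ≡⟨ cong (_++ u ++ y ++ inv u) (sym (++-assoc u x (inv u))) ⟩
  ((u ++ x) ++ inv u) ++ u ++ y ++ inv u ≡⟨ ++-assoc (u ++ x) (inv u) _ ⟩
  (u ++ x) ++ inv u ++ u ++ y ++ inv u   ≡⟨ cong ((u ++ x) ++_) (sym (++-assoc (inv u) u _)) ⟩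
  (u ++ x) ++ (inv u ++ u) ++ y ++ inv u ≈⟨ ++-congʳ (u ++ x) ((inv u ++ u) ++ y ++ inv u) (y ++ inv u)
                                              (++-congˡ (inv u ++ u) [] (y ++ inv u) (inv-left u)) ⟩
  (u ++ x) ++ y ++ inv u                 ≡⟨ ++-assoc u x (y ++ inv u) ⟩
  u ++ x ++ y ++ inv u                   ≡⟨ cong (u ++_) (sym (++-assoc x y (inv u))) ⟩
  u ++ (x ++ y) ++ inv u ∎

Lgen-empty : ∀ g → Lgen g [] ≈ conjugate (g ∷ []) (Rgen g [])
Lgen-empty (pos a) = refl
Lgen-empty (pos b) = refl
Lgen-empty (neg a) = refl
Lgen-empty (neg b) = refl

Lgen-letter : ∀ g h → Lgen g (h ∷ []) ≈ conjugate (g ∷ []) (Rgen g (h ∷ []))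
Lgen-letter (pos a) (pos a) = refl
Lgen-letter (pos a) (pos b) = refl
Lgen-letter (pos a) (neg a) = refl
Lgen-letter (pos a) (neg b) = refl
Lgen-letter (pos b) (pos a) = refl
Lgen-letter (pos b) (pos b) = refl
Lgen-letter (pos b) (neg a) = refl
Lgen-letter (pos b) (neg b) = refl
Lgen-letter (neg a) (pos a) = refl
Lgen-letter (neg a) (pos b) = refl
Lgen-letter (neg a) (neg a) = refl
Lgen-letter (neg a) (neg b) = refl
Lgen-letter (neg b) (pos a) = refl
Lgen-letter (neg b) (pos b) = refl
Lgen-letter (neg b) (neg a) = refl
Lgen-letter (neg b) (neg b) = refl

-- L_g(x) = g R_g(x) g⁻¹ in F₂, since both sides are multiplicative in x.
Lgen-conjugate : ∀ g x → Lgen g x ≈ conjugate (g ∷ []) (Rgen g x)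
Lgen-conjugate g [] = Lgen-empty g
Lgen-conjugate g (h ∷ x) = begin
  Lgen g (h ∷ x)                        ≡⟨ Lgen-++ g (h ∷ []) x ⟩
  Lgen g (h ∷ []) ++ Lgen g x           ≈⟨ ++-cong (Lgen g (h ∷ [])) (conjugate [g] (Rgen g (h ∷ [])))
                                                 (Lgen g x) (conjugate [g] (Rgen g x))
                                                 (Lgen-letter g h) (Lgen-conjugate g x) ⟩
  conjugate [g] (Rgen g (h ∷ [])) ++ conjugate [g] (Rgen g x)
                                        ≈⟨ conjugate-++ [g] (Rgen g (h ∷ [])) (Rgen g x) ⟩
  conjugate [g] (Rgen g (h ∷ []) ++ Rgen g x)
                                        ≡⟨ cong (conjugate [g]) (sym (Rgen-++ g (h ∷ []) x)) ⟩
  conjugate [g] (Rgen g (h ∷ x)) ∎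
  where [g] = g ∷ []

b⁻¹a⁻¹ : Word
b⁻¹a⁻¹ = neg b ∷ neg a ∷ []

-- Boundary identities: R_g(ab) = ab g and R_g(ba) = ba g, in the form needed.
boundary-left : ∀ g → (g ∷ Rgen g b⁻¹a⁻¹) ≈ b⁻¹a⁻¹
boundary-left (pos a) = refl
boundary-left (pos b) = refl
boundary-left (neg a) = refl
boundary-left (neg b) = refl

boundary-right : ∀ g → (Rgen g ba ++ inv-gen g ∷ []) ≈ ba
boundary-right (pos a) = refl
boundary-right (pos b) = refl
boundary-right (neg a) = refl
boundary-right (neg b) = refl

conjugate-Rgen-split : ∀ g p q r →
  conjugate (g ∷ []) (Rgen g (p ++ q ++ r))
    ≡ (g ∷ Rgen g p) ++ Rgen g q ++ Rgen g r ++ inv-gen g ∷ []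
conjugate-Rgen-split g p q r =
  cong (g ∷_) (trans (cong (_++ inv-gen g ∷ []) split)
                     (reassoc (Rgen g p) (Rgen g q) (Rgen g r)))
  where
  split : Rgen g (p ++ q ++ r) ≡ Rgen g p ++ Rgen g q ++ Rgen g r
  split = trans (Rgen-++ g p (q ++ r)) (cong (Rgen g p ++_) (Rgen-++ g q r))
  reassoc : ∀ x y z → (x ++ y ++ z) ++ inv-gen g ∷ [] ≡ x ++ y ++ z ++ inv-gen g ∷ []
  reassoc x y z = trans (++-assoc x (y ++ z) _) (cong (x ++_) (++-assoc y z _))

-- Main theorem: L_w(ba) = Pal(w) ba; note Pal w ++ ba is b⁻¹a⁻¹ ++ R w ab ++ ba.
lemma4p2 : (w : Word) → L w ba ≈ Pal w ++ ba
lemma4p2 [] = refl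
lemma4p2 (g ∷ w) = begin
  Lgen g (L w ba)                                ≈⟨ Lgen-cong g (L w ba) (b⁻¹a⁻¹ ++ X ++ ba)
                                                                (lemma4p2 w) ⟩
  Lgen g (b⁻¹a⁻¹ ++ X ++ ba)                     ≈⟨ Lgen-conjugate g (b⁻¹a⁻¹ ++ X ++ ba) ⟩
  conjugate (g ∷ []) (Rgen g (b⁻¹a⁻¹ ++ X ++ ba)) ≡⟨ conjugate-Rgen-split g b⁻¹a⁻¹ X ba ⟩
  (g ∷ Rgen g b⁻¹a⁻¹) ++ Rgen g X ++ Rgen g ba ++ inv-gen g ∷ []
    ≈⟨ ++-cong (g ∷ Rgen g b⁻¹a⁻¹) b⁻¹a⁻¹ (Rgen g X ++ Rgen g ba ++ inv-gen g ∷ []) (Rgen g X ++ ba)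
               (boundary-left g)
               (++-congʳ (Rgen g X) (Rgen g ba ++ inv-gen g ∷ []) ba (boundary-right g)) ⟩
  b⁻¹a⁻¹ ++ Rgen g X ++ ba ∎
  where X = R w ab
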